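{- Let $H^*_{\mathbb{Q}(i),3}$ be the greedy set of nonzero Gaussian integers avoiding $3$-term geometric progressions with ratios in $\mathbb{Z}\setminus\{0,\pm1\}$. A nonzero Gaussian integer $a+bi$ is excluded from $H^*_{\mathbb{Q}(i),3}$ if and only if it can be written as $a+bi=k(c+di)$ where $k$ is a positive integer not in $G_3^*$ and $c,d$ are integers with $\gcd(c,d)=1$.
   Context: A $3$-term geometric progression with ratio in $\mathbb{Z}\setminus\{0,\pm 1\}$ in $\mathbb{Z}[i]$ is a set $\{n,nr,nr^2\}$ with $n\in\mathbb{Z}[i]$ nonzero and $r\in\mathbb{Z}$, $|r|\ge 2$. The greedy set $H^*_{\mathbb{Q}(i),3}$ is built by going through the nonzero Gaussian integers in order of nondecreasing norm $N(a+bi)=a^2+b^2$ (ties in arbitrary order), including an element if and only if it does not form such a progression with two elements already included. $G_3^*=\{1,2,3,5,6,7,8,10,\dots\}$ is Rankin's greedy set: the set of positive integers obtained by going through $1,2,3,\dots$ in order and including an integer if and only if it does not form a progression $\{n,nr,nr^2\}$ (with $n,r$ positive integers, $r\ge2$) with two integers already included. Equivalently, $G_3^*$ consists of the positive integers all of whose prime exponents have no digit $2$ in base $3$. -}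

module Defs where

open import Data.Nat as ℕ using (ℕ; _≤_; _<_)
open import Data.Integer as ℤ using (ℤ; +_; ∣_∣; 0ℤ)
open import Data.Product using (_×_; _,_; ∃; ∃-syntax)
open import Data.Sum using (_⊎_)
open import Relation.Nullary using (¬_)
open import Relation.Binary.PropositionalEquality using (_≡_; _≢_)
open import Relation.Binary.Structures using (IsStrictTotalOrder)

-- Gaussian integers a + b i as pairs (a , b) of integers

ℤ[i] : Set
ℤ[i] = ℤ × ℤ

0ᵍ : ℤ[i]
0ᵍ = 0ℤ , 0ℤ

N : ℤ[i] → ℕ
N (a , b) = ∣ a ∣ ℕ.* ∣ a ∣ ℕ.+ ∣ b ∣ ℕ.* ∣ b ∣

_·_ : ℤ → ℤ[i] → ℤ[i]
r · (a , b) = (r ℤ.* a) , (r ℤ.* b)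

-- Three elements x y z form the 3-term progression {n, nr, nr²}:
-- they are pairwise distinct and each lies in {n, nr, nr²}
-- (so {x,y,z} = {n,nr,nr²}, as the latter has three distinct elements).

_∈3_ : {A : Set} → A → A × A × A → Set
x ∈3 (p , q , s) = x ≡ p ⊎ x ≡ q ⊎ x ≡ s

Distinct3 : {A : Set} → A → A → A → Set
Distinct3 x y z = x ≢ y × x ≢ z × y ≢ z

FormGPᵍ : ℤ[i] → ℤ[i] → ℤ[i] → Set
FormGPᵍ x y z =
  ∃[ n ] ∃[ r ] (n ≢ 0ᵍ × 2 ≤ ∣ r ∣ ×
    (let T = (n , r · n , r · (r · n)) in
     Distinct3 x y z × x ∈3 T × y ∈3 T × z ∈3 T))

FormGPℕ : ℕ → ℕ → ℕ → Set
FormGPℕ x y z =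
  ∃[ n ] ∃[ r ] (1 ≤ n × 2 ≤ r ×
    (let T = (n , n ℕ.* r , n ℕ.* r ℕ.* r) in
     Distinct3 x y z × x ∈3 T × y ∈3 T × z ∈3 T))

-- Rankin's greedy set G₃* : going through 1, 2, 3, … in order, k is
-- included iff it does not form a progression with two already
-- included (hence smaller) integers.  G is the characteristic
-- predicate; this specification determines it uniquely.

IsRankinGreedy : (ℕ → Set) → Set
IsRankinGreedy G =
  ∀ k → (G k → 1 ≤ k × ¬ (∃[ x ] ∃[ y ] (x < k × y < k × G x × G y × FormGPℕ k x y)))
      × (1 ≤ k × ¬ (∃[ x ] ∃[ y ] (x < k × y < k × G x × G y × FormGPℕ k x y)) → G k)

-- An admissible enumeration order of the nonzero Gaussian integers:
-- a strict total order ("comes before") which goes by nondecreasing norm,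
-- ties broken arbitrarily.
IsNormOrder : (ℤ[i] → ℤ[i] → Set) → Set
IsNormOrder _≺_ =
  IsStrictTotalOrder _≡_ _≺_
  × (∀ x y → N x < N y → x ≺ y)
  × (∀ x y → x ≺ y → N x ≤ N y)

-- The greedy set H*_{ℚ(i),3} with respect to the enumeration order ≺:
-- a nonzero z is included iff it does not form a progression (ratio in
-- ℤ \ {0, ±1}) with two elements already included (i.e. earlier in ≺).
IsGaussGreedy : (ℤ[i] → ℤ[i] → Set) → (ℤ[i] → Set) → Set
IsGaussGreedy _≺_ H =
  ∀ z → (H z → z ≢ 0ᵍ × ¬ (∃[ x ] ∃[ y ] (x ≺ z × y ≺ z × H x × H y × FormGPᵍ z x y)))
      × (z ≢ 0ᵍ × ¬ (∃[ x ] ∃[ y ] (x ≺ z × y ≺ z × H x × H y × FormGPᵍ z x y)) → H z)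

-- Lemma 3.9: a nonzero Gaussian integer z lies outside the greedy set
-- H*_{ℚ(i),3} exactly when its content (the gcd of its coordinates) lies
-- outside Rankin's greedy set G₃*.
--
-- Writing z = k · p with k = content z and p primitive, a progression
-- {n, rn, r²n} (r ∈ ℤ, |r| ≥ 2) of Gaussian integers is, up to the common
-- primitive direction, a progression {u, uR, uR²} of contents with R = |r|:
--   * descent: a Gaussian progression in which z has the largest norm has z
--     as its last term, and the contents form a progression of naturals
--     in which content z is largest;
--   * ascent: conversely a progression of naturals ending at content z lifts
--     to a Gaussian progression ending at z, along the primitive part of z.
-- Since the enumeration goes by norm, the two greedy constructions then
-- make the same decisions: by well-founded induction on N z,
-- H z ⇔ G (content z) for every nonzero z.  The theorem follows from this
-- correspondence together with the decomposition z = content z · p.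

module Submission where

open import Defs
open import Data.Nat using (ℕ; _≤_)
open import Data.Integer using (ℤ; +_; _*_)
open import Data.Integer.GCD using (gcd)
open import Data.Product using (_×_; _,_; ∃-syntax; proj₁; proj₂)
open import Relation.Nullary using (¬_)
open import Relation.Binary.PropositionalEquality using (_≡_; _≢_; refl; sym; trans; cong; cong₂; subst; subst₂; module ≡-Reasoning)

import Data.Nat as ℕ
import Data.Nat.Properties as ℕ
import Data.Nat.GCD as ℕ
import Data.Nat.Induction as ℕ
import Data.Integer as ℤ
import Data.Integer.Properties as ℤ
open import Data.Integer.Divisibility.Signed using (divides; ∣ᵤ⇒∣)
open import Data.Sum using (_⊎_; inj₁; inj₂)
open import Data.Empty using (⊥; ⊥-elim)
open import Function using (id; _⇔_; mk⇔; Equivalence)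
open import Induction.WellFounded using (module All)
open import Relation.Binary.Construct.On as On using ()
open import Algebra.Properties.CommutativeSemigroup ℕ.*-commutativeSemigroup using (interchange)

Members3 : {A : Set} → A × A × A → A → A → A → Set
Members3 T z x y = Distinct3 z x y × z ∈3 T × x ∈3 T × y ∈3 T

members-swap : {A : Set} {T : A × A × A} {z x y : A} →
               Members3 T z x y → Members3 T z y x
members-swap ((z≢x , z≢y , x≢y) , z∈ , x∈ , y∈) =
  (z≢y , z≢x , λ y≡x → x≢y (sym y≡x)) , z∈ , y∈ , x∈

last-of-three : {A : Set} (f : A → ℕ) {p q s z x y : A} →
  f p ℕ.< f q → f q ℕ.< f s → Members3 (p , q , s) z x y →
  f x ℕ.≤ f z → f y ℕ.≤ f z →
  z ≡ s × ((x ≡ p × y ≡ q) ⊎ (x ≡ q × y ≡ p))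
last-of-three f _ _ (_ , inj₂ (inj₂ refl) , inj₁ refl , inj₂ (inj₁ refl)) _ _ = refl , inj₁ (refl , refl)
last-of-three f _ _ (_ , inj₂ (inj₂ refl) , inj₂ (inj₁ refl) , inj₁ refl) _ _ = refl , inj₂ (refl , refl)
last-of-three f p<q _ (_ , inj₁ refl , inj₂ (inj₁ refl) , _) x≤z _ = ⊥-elim (ℕ.<⇒≱ p<q x≤z)
last-of-three f p<q q<s (_ , inj₁ refl , inj₂ (inj₂ refl) , _) x≤z _ = ⊥-elim (ℕ.<⇒≱ (ℕ.<-trans p<q q<s) x≤z)
last-of-three f _ q<s (_ , inj₂ (inj₁ refl) , inj₂ (inj₂ refl) , _) x≤z _ = ⊥-elim (ℕ.<⇒≱ q<s x≤z)
last-of-three f _ q<s (_ , inj₂ (inj₁ refl) , inj₁ refl , inj₂ (inj₂ refl)) _ y≤z = ⊥-elim (ℕ.<⇒≱ q<s y≤z)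
last-of-three f _ _ ((z≢x , _) , inj₁ refl , inj₁ refl , _) _ _ = ⊥-elim (z≢x refl)
last-of-three f _ _ ((z≢x , _) , inj₂ (inj₁ refl) , inj₂ (inj₁ refl) , _) _ _ = ⊥-elim (z≢x refl)
last-of-three f _ _ ((z≢x , _) , inj₂ (inj₂ refl) , inj₂ (inj₂ refl) , _) _ _ = ⊥-elim (z≢x refl)
last-of-three f _ _ ((_ , z≢y , _) , inj₂ (inj₁ refl) , inj₁ refl , inj₂ (inj₁ refl)) _ _ = ⊥-elim (z≢y refl)
last-of-three f _ _ ((_ , z≢y , _) , inj₂ (inj₂ refl) , inj₁ refl , inj₂ (inj₂ refl)) _ _ = ⊥-elim (z≢y refl)
last-of-three f _ _ ((_ , z≢y , _) , inj₂ (inj₂ refl) , inj₂ (inj₁ refl) , inj₂ (inj₂ refl)) _ _ = ⊥-elim (z≢y refl)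
last-of-three f _ _ ((_ , _ , x≢y) , inj₂ (inj₁ refl) , inj₁ refl , inj₁ refl) _ _ = ⊥-elim (x≢y refl)
last-of-three f _ _ ((_ , _ , x≢y) , inj₂ (inj₂ refl) , inj₁ refl , inj₁ refl) _ _ = ⊥-elim (x≢y refl)
last-of-three f _ _ ((_ , _ , x≢y) , inj₂ (inj₂ refl) , inj₂ (inj₁ refl) , inj₂ (inj₁ refl)) _ _ = ⊥-elim (x≢y refl)

FormGPℕ-swap : ∀ {z x y} → FormGPℕ z x y → FormGPℕ z y x
FormGPℕ-swap (n , r , n≥1 , r≥2 , members) = n , r , n≥1 , r≥2 , members-swap members

FormGPᵍ-swap : ∀ {z x y} → FormGPᵍ z x y → FormGPᵍ z y x
FormGPᵍ-swap (n , r , n≢0 , r≥2 , members) = n , r , n≢0 , r≥2 , members-swap members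

-- The content of a + b i is gcd(|a|, |b|); by definition gcd a b ≡ + content (a , b).
content : ℤ[i] → ℕ
content (a , b) = ℕ.gcd ℤ.∣ a ∣ ℤ.∣ b ∣

·-assoc : ∀ s t w → s · (t · w) ≡ (s * t) · w
·-assoc s t (a , b) = cong₂ _,_ (sym (ℤ.*-assoc s t a)) (sym (ℤ.*-assoc s t b))

norm-scale : ∀ r w → N (r · w) ≡ ℤ.∣ r ∣ ℕ.* ℤ.∣ r ∣ ℕ.* N w
norm-scale r (a , b) rewrite ℤ.abs-* r a | ℤ.abs-* r b = scaled-squares ℤ.∣ r ∣ ℤ.∣ a ∣ ℤ.∣ b ∣
  where
  scaled-squares : ∀ R A B → R ℕ.* A ℕ.* (R ℕ.* A) ℕ.+ R ℕ.* B ℕ.* (R ℕ.* B)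
                           ≡ R ℕ.* R ℕ.* (A ℕ.* A ℕ.+ B ℕ.* B)
  scaled-squares R A B =
    trans (cong₂ ℕ._+_ (interchange R A R A) (interchange R B R B))
          (sym (ℕ.*-distribˡ-+ (R ℕ.* R) (A ℕ.* A) (B ℕ.* B)))

content-scale : ∀ r w → content (r · w) ≡ ℤ.∣ r ∣ ℕ.* content w
content-scale r (a , b) rewrite ℤ.abs-* r a | ℤ.abs-* r b =
  sym (ℕ.c*gcd[m,n]≡gcd[cm,cn] ℤ.∣ r ∣ ℤ.∣ a ∣ ℤ.∣ b ∣)

norm-pos : ∀ {w} → w ≢ 0ᵍ → 0 ℕ.< N w
norm-pos {ℤ.+[1+ n ] , b}      _   = ℕ.z<s
norm-pos {ℤ.-[1+ n ] , b}      _   = ℕ.z<s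
norm-pos {ℤ.+0 , ℤ.+[1+ n ]}   _   = ℕ.z<s
norm-pos {ℤ.+0 , ℤ.-[1+ n ]}   _   = ℕ.z<s
norm-pos {ℤ.+0 , ℤ.+0}         w≢0 = ⊥-elim (w≢0 refl)

content-pos : ∀ {w} → w ≢ 0ᵍ → 0 ℕ.< content w
content-pos {a , b} w≢0 = ℕ.n≢0⇒n>0 λ g≡0 →
  w≢0 (cong₂ _,_ (ℤ.∣i∣≡0⇒i≡0 (ℕ.gcd[m,n]≡0⇒m≡0 g≡0))
                 (ℤ.∣i∣≡0⇒i≡0 (ℕ.gcd[m,n]≡0⇒n≡0 ℤ.∣ a ∣ g≡0)))

content-pos⇒nonzero : ∀ {w} → 0 ℕ.< content w → w ≢ 0ᵍ
content-pos⇒nonzero p refl = ℕ.<-irrefl (sym ℕ.gcd[0,0]≡0) p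

content-multiple : ∀ k c d → gcd c d ≡ + 1 → content ((+ k) · (c , d)) ≡ k
content-multiple k c d prim = begin
  content ((+ k) · (c , d))  ≡⟨ content-scale (+ k) (c , d) ⟩
  k ℕ.* content (c , d)      ≡⟨ cong (k ℕ.*_) (ℤ.+-injective prim) ⟩
  k ℕ.* 1                    ≡⟨ ℕ.*-identityʳ k ⟩
  k                          ∎
  where open ≡-Reasoning

primitive-part : ∀ z → z ≢ 0ᵍ →
  ∃[ c ] ∃[ d ] (gcd c d ≡ + 1 × z ≡ (+ content z) · (c , d))
primitive-part z@(a , b) z≢0
  with ∣ᵤ⇒∣ {+ content z} {a} (ℕ.gcd[m,n]∣m ℤ.∣ a ∣ ℤ.∣ b ∣)
     | ∣ᵤ⇒∣ {+ content z} {b} (ℕ.gcd[m,n]∣n ℤ.∣ a ∣ ℤ.∣ b ∣)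
... | divides c a≡ | divides d b≡ = c , d , cong +_ prim , z≡
  where
  k : ℕ
  k = content z
  z≡ : z ≡ (+ k) · (c , d)
  z≡ = cong₂ _,_ (trans a≡ (ℤ.*-comm c (+ k))) (trans b≡ (ℤ.*-comm d (+ k)))
  prim : content (c , d) ≡ 1
  prim = ℕ.*-cancelˡ-≡ (content (c , d)) 1 k ⦃ ℕ.>-nonZero (content-pos z≢0) ⦄
    (begin
      k ℕ.* content (c , d)      ≡⟨ sym (content-scale (+ k) (c , d)) ⟩
      content ((+ k) · (c , d))  ≡⟨ cong content (sym z≡) ⟩
      k                          ≡⟨ sym (ℕ.*-identityʳ k) ⟩
      k ℕ.* 1                    ∎)
    where open ≡-Reasoning

distinct-by-size : {A : Set} (f : A → ℕ) {a b c : A} →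
  f a ℕ.< f b → f b ℕ.< f c → Distinct3 c a b
distinct-by-size f a<b b<c =
  (λ c≡a → ℕ.<-irrefl (cong f (sym c≡a)) (ℕ.<-trans a<b b<c)) ,
  (λ c≡b → ℕ.<-irrefl (cong f (sym c≡b)) b<c) ,
  (λ a≡b → ℕ.<-irrefl (cong f a≡b) a<b)

increasingℕ : ∀ {u R} → 1 ℕ.≤ u → 2 ℕ.≤ R → u ℕ.< u ℕ.* R × u ℕ.* R ℕ.< u ℕ.* R ℕ.* R
increasingℕ {u} {R} u≥1 R≥2 = u<uR , ℕ.m<m*n (u ℕ.* R) R ⦃ ℕ.>-nonZero (ℕ.<-trans u≥1 u<uR) ⦄ R≥2
  where
  u<uR : u ℕ.< u ℕ.* R
  u<uR = ℕ.m<m*n u R ⦃ ℕ.>-nonZero u≥1 ⦄ R≥2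

canonicalℕ : ∀ {u R} → 1 ℕ.≤ u → 2 ℕ.≤ R → FormGPℕ (u ℕ.* R ℕ.* R) u (u ℕ.* R)
canonicalℕ {u} {R} u≥1 R≥2 =
  u , R , u≥1 , R≥2 , distinct-by-size id u<uR uR<uRR ,
  inj₂ (inj₂ refl) , inj₁ refl , inj₂ (inj₁ refl)
  where
  u<uR : u ℕ.< u ℕ.* R
  u<uR = proj₁ (increasingℕ u≥1 R≥2)
  uR<uRR : u ℕ.* R ℕ.< u ℕ.* R ℕ.* R
  uR<uRR = proj₂ (increasingℕ u≥1 R≥2)

norm-grows : ∀ {w} r → 0 ℕ.< N w → 2 ℕ.≤ ℤ.∣ r ∣ → N w ℕ.< N (r · w)
norm-grows {w} r Nw>0 r≥2 = subst (N w ℕ.<_) (sym (norm-scale r w))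
  (subst (N w ℕ.<_) (ℕ.*-comm (N w) (R ℕ.* R))
    (ℕ.m<m*n (N w) (R ℕ.* R) ⦃ ℕ.>-nonZero Nw>0 ⦄ (ℕ.≤-trans r≥2 R≤R²)))
  where
  R : ℕ
  R = ℤ.∣ r ∣
  R≤R² : R ℕ.≤ R ℕ.* R
  R≤R² = ℕ.m≤m*n R R ⦃ ℕ.>-nonZero (ℕ.≤-trans (ℕ.s≤s ℕ.z≤n) r≥2) ⦄

increasingᵍ : ∀ n r → n ≢ 0ᵍ → 2 ℕ.≤ ℤ.∣ r ∣ →
  N n ℕ.< N (r · n) × N (r · n) ℕ.< N (r · (r · n))
increasingᵍ n r n≢0 r≥2 = n<rn , norm-grows r (ℕ.<-trans (norm-pos n≢0) n<rn) r≥2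
  where
  n<rn : N n ℕ.< N (r · n)
  n<rn = norm-grows r (norm-pos n≢0) r≥2

canonicalᵍ : ∀ n r → n ≢ 0ᵍ → 2 ℕ.≤ ℤ.∣ r ∣ → FormGPᵍ (r · (r · n)) n (r · n)
canonicalᵍ n r n≢0 r≥2 =
  n , r , n≢0 , r≥2 ,
  distinct-by-size N (proj₁ (increasingᵍ n r n≢0 r≥2)) (proj₂ (increasingᵍ n r n≢0 r≥2)) ,
  inj₂ (inj₂ refl) , inj₁ refl , inj₂ (inj₁ refl)

-- Descent and ascent between Gaussian and natural progressions

Descent : ℤ[i] → ℤ[i] → ℤ[i] → Set
Descent z x y = N x ℕ.< N z × N y ℕ.< N z ×
  content x ℕ.< content z × content y ℕ.< content z × FormGPℕ (content z) (content x) (content y)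

descent-swap : ∀ {z x y} → Descent z x y → Descent z y x
descent-swap (Nx< , Ny< , cx< , cy< , gp) = Ny< , Nx< , cy< , cx< , FormGPℕ-swap gp

-- In {n, rn, r²n} the contents are u, uR, uR² with u = content n, R = |r|.
descend-canonical : ∀ n r → n ≢ 0ᵍ → 2 ℕ.≤ ℤ.∣ r ∣ → Descent (r · (r · n)) n (r · n)
descend-canonical n r n≢0 r≥2 =
  ℕ.<-trans n<rn rn<rrn , rn<rrn ,
  subst (u ℕ.<_) (sym rrn≡) (ℕ.<-trans u<uR uR<uRR) ,
  subst₂ ℕ._<_ (sym rn≡) (sym rrn≡) uR<uRR ,
  subst₂ (λ c b → FormGPℕ c u b) (sym rrn≡) (sym rn≡) (canonicalℕ u≥1 r≥2)
  where
  u R : ℕ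
  u = content n
  R = ℤ.∣ r ∣
  u≥1 : 1 ℕ.≤ u
  u≥1 = content-pos n≢0
  n<rn : N n ℕ.< N (r · n)
  n<rn = proj₁ (increasingᵍ n r n≢0 r≥2)
  rn<rrn : N (r · n) ℕ.< N (r · (r · n))
  rn<rrn = proj₂ (increasingᵍ n r n≢0 r≥2)
  u<uR : u ℕ.< u ℕ.* R
  u<uR = proj₁ (increasingℕ u≥1 r≥2)
  uR<uRR : u ℕ.* R ℕ.< u ℕ.* R ℕ.* R
  uR<uRR = proj₂ (increasingℕ u≥1 r≥2)
  rn≡ : content (r · n) ≡ u ℕ.* R
  rn≡ = trans (content-scale r n) (ℕ.*-comm R u)
  rrn≡ : content (r · (r · n)) ≡ u ℕ.* R ℕ.* R
  rrn≡ = trans (content-scale r (r · n)) (trans (ℕ.*-comm R (content (r · n))) (cong (ℕ._* R) rn≡))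

descend : ∀ {z x y} → FormGPᵍ z x y → N x ℕ.≤ N z → N y ℕ.≤ N z → Descent z x y
descend (n , r , n≢0 , r≥2 , members) x≤z y≤z
  with last-of-three N {n} {r · n} {r · (r · n)}
         (proj₁ (increasingᵍ n r n≢0 r≥2)) (proj₂ (increasingᵍ n r n≢0 r≥2)) members x≤z y≤z
... | refl , inj₁ (refl , refl) = descend-canonical n r n≢0 r≥2
... | refl , inj₂ (refl , refl) = descent-swap {r · (r · n)} {n} {r · n} (descend-canonical n r n≢0 r≥2)

Lift : ℤ[i] → ℕ → ℕ → Set
Lift z a b = ∃[ x ] ∃[ y ]
  (content x ≡ a × content y ≡ b × N x ℕ.< N z × N y ℕ.< N z × FormGPᵍ z x y)

lift-swap : ∀ {z a b} → Lift z a b → Lift z b a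
lift-swap (x , y , cx , cy , Nx< , Ny< , gp) = y , x , cy , cx , Ny< , Nx< , FormGPᵍ-swap gp

lift-canonical : ∀ n r → n ≢ 0ᵍ → 2 ℕ.≤ ℤ.∣ r ∣ → Lift (r · (r · n)) (content n) (content (r · n))
lift-canonical n r n≢0 r≥2 =
  n , r · n , refl , refl ,
  ℕ.<-trans (proj₁ (increasingᵍ n r n≢0 r≥2)) (proj₂ (increasingᵍ n r n≢0 r≥2)) ,
  proj₂ (increasingᵍ n r n≢0 r≥2) , canonicalᵍ n r n≢0 r≥2

-- If content z = uR², the progression u, uR lifts along the primitive part p of
-- z: z = R · (R · n') with n' = u · p.
ascend-canonical : ∀ {z u R} → z ≢ 0ᵍ → 1 ℕ.≤ u → 2 ℕ.≤ R →
  content z ≡ u ℕ.* R ℕ.* R → Lift z u (u ℕ.* R)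
ascend-canonical {z} {u} {R} z≢0 u≥1 R≥2 cz≡ with primitive-part z z≢0
... | c , d , prim , z≡ =
  subst₂ (Lift z) cn' crn'
    (subst (λ w → Lift w (content n') (content ((+ R) · n'))) (sym z≡RRn')
      (lift-canonical n' (+ R) n'≢0 R≥2))
  where
  p n' : ℤ[i]
  p = (c , d)
  n' = (+ u) · p
  cn' : content n' ≡ u
  cn' = content-multiple u c d prim
  crn' : content ((+ R) · n') ≡ u ℕ.* R
  crn' = trans (content-scale (+ R) n') (trans (cong (R ℕ.*_) cn') (ℕ.*-comm R u))
  n'≢0 : n' ≢ 0ᵍ
  n'≢0 = content-pos⇒nonzero (subst (0 ℕ.<_) (sym cn') u≥1)
  uRR≡RRu : u ℕ.* R ℕ.* R ≡ R ℕ.* (R ℕ.* u)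
  uRR≡RRu = trans (ℕ.*-comm (u ℕ.* R) R) (cong (R ℕ.*_) (ℕ.*-comm u R))
  z≡RRn' : z ≡ (+ R) · ((+ R) · n')
  z≡RRn' = begin
    z                          ≡⟨ z≡ ⟩
    (+ content z) · p          ≡⟨ cong (λ k → (+ k) · p) (trans cz≡ uRR≡RRu) ⟩
    (+ (R ℕ.* (R ℕ.* u))) · p  ≡⟨ cong (_· p) (trans (ℤ.pos-* R (R ℕ.* u)) (cong (+ R *_) (ℤ.pos-* R u))) ⟩
    (+ R * (+ R * + u)) · p    ≡⟨ sym (·-assoc (+ R) (+ R * + u) p) ⟩
    (+ R) · ((+ R * + u) · p)  ≡⟨ cong ((+ R) ·_) (sym (·-assoc (+ R) (+ u) p)) ⟩
    (+ R) · ((+ R) · n')       ∎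
    where open ≡-Reasoning

ascend : ∀ {z a b} → z ≢ 0ᵍ → FormGPℕ (content z) a b →
  a ℕ.≤ content z → b ℕ.≤ content z → Lift z a b
ascend z≢0 (u , R , u≥1 , R≥2 , members) a≤ b≤
  with last-of-three id (proj₁ (increasingℕ u≥1 R≥2)) (proj₂ (increasingℕ u≥1 R≥2)) members a≤ b≤
... | cz≡ , inj₁ (refl , refl) = ascend-canonical z≢0 u≥1 R≥2 cz≡
... | cz≡ , inj₂ (refl , refl) = lift-swap (ascend-canonical z≢0 u≥1 R≥2 cz≡)

-- The two greedy constructions correspond

module GreedyCorrespondence
  {G : ℕ → Set} (rankin : IsRankinGreedy G)
  {_≺_ : ℤ[i] → ℤ[i] → Set} (order : IsNormOrder _≺_)
  {H : ℤ[i] → Set} (greedy : IsGaussGreedy _≺_ H) where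

  RankinBlocked : ℕ → Set
  RankinBlocked k = ∃[ x ] ∃[ y ] (x ℕ.< k × y ℕ.< k × G x × G y × FormGPℕ k x y)

  GaussBlocked : ℤ[i] → Set
  GaussBlocked z = ∃[ x ] ∃[ y ] (x ≺ z × y ≺ z × H x × H y × FormGPᵍ z x y)

  G-positive : ∀ {k} → G k → 1 ℕ.≤ k
  G-positive {k} Gk = proj₁ (proj₁ (rankin k) Gk)

  G-unblocked : ∀ {k} → G k → ¬ RankinBlocked k
  G-unblocked {k} Gk = proj₂ (proj₁ (rankin k) Gk)

  G-include : ∀ k → 1 ℕ.≤ k × ¬ RankinBlocked k → G k
  G-include k = proj₂ (rankin k)

  H-nonzero : ∀ {z} → H z → z ≢ 0ᵍ
  H-nonzero {z} Hz = proj₁ (proj₁ (greedy z) Hz)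

  H-unblocked : ∀ {z} → H z → ¬ GaussBlocked z
  H-unblocked {z} Hz = proj₂ (proj₁ (greedy z) Hz)

  H-include : ∀ z → z ≢ 0ᵍ × ¬ GaussBlocked z → H z
  H-include z = proj₂ (greedy z)

  norm-before : ∀ x y → N x ℕ.< N y → x ≺ y
  norm-before = proj₁ (proj₂ order)

  before-norm : ∀ x y → x ≺ y → N x ℕ.≤ N y
  before-norm = proj₂ (proj₂ order)

  Below : ℤ[i] → Set
  Below z = ∀ {w} → N w ℕ.< N z → w ≢ 0ᵍ → H w ⇔ G (content w)

  -- Any progression blocking content z lifts to one blocking z.
  H⇒G : ∀ {z} → z ≢ 0ᵍ → Below z → H z → G (content z)
  H⇒G {z} z≢0 ih Hz = G-include (content z) (content-pos z≢0 , blocked)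
    where
    earlier : ∀ {w} → N w ℕ.< N z → G (content w) → H w
    earlier Nw< Gw = Equivalence.from (ih Nw< (content-pos⇒nonzero (G-positive Gw))) Gw
    blocked : RankinBlocked (content z) → ⊥
    blocked (a , b , a< , b< , Ga , Gb , gp) with ascend z≢0 gp (ℕ.<⇒≤ a<) (ℕ.<⇒≤ b<)
    ... | x , y , refl , refl , Nx< , Ny< , gpᵍ =
      H-unblocked Hz (x , y , norm-before x z Nx< , norm-before y z Ny< , earlier Nx< Ga , earlier Ny< Gb , gpᵍ)

  -- Any progression blocking z descends to one blocking content z.
  G⇒H : ∀ {z} → z ≢ 0ᵍ → Below z → G (content z) → H z
  G⇒H {z} z≢0 ih Gz = H-include z (z≢0 , blocked)
    where
    earlier : ∀ {w} → N w ℕ.< N z → H w → G (content w)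
    earlier Nw< Hw = Equivalence.to (ih Nw< (H-nonzero Hw)) Hw
    blocked : GaussBlocked z → ⊥
    blocked (x , y , x≺ , y≺ , Hx , Hy , gp)
      with descend gp (before-norm x z x≺) (before-norm y z y≺)
    ... | Nx< , Ny< , cx< , cy< , gpℕ =
      G-unblocked Gz (content x , content y , cx< , cy< , earlier Nx< Hx , earlier Ny< Hy , gpℕ)

  correspondence : ∀ z → z ≢ 0ᵍ → H z ⇔ G (content z)
  correspondence = All.wfRec (On.wellFounded N ℕ.<-wellFounded) _
    (λ z → z ≢ 0ᵍ → H z ⇔ G (content z))
    (λ z ih z≢0 → mk⇔ (H⇒G z≢0 ih) (G⇒H z≢0 ih))

lemma3p9 : (G : ℕ → Set) → IsRankinGreedy G →
    (_≺_ : ℤ[i] → ℤ[i] → Set) → IsNormOrder _≺_ →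
    (H : ℤ[i] → Set) → IsGaussGreedy _≺_ H →
    (z : ℤ[i]) → z ≢ 0ᵍ →
    (¬ H z → ∃[ k ] ∃[ c ] ∃[ d ] (1 ≤ k × ¬ G k × gcd c d ≡ + 1 × z ≡ ((+ k * c) , (+ k * d))))
    × (∃[ k ] ∃[ c ] ∃[ d ] (1 ≤ k × ¬ G k × gcd c d ≡ + 1 × z ≡ ((+ k * c) , (+ k * d))) → ¬ H z)
lemma3p9 G rankin _≺_ order H greedy z z≢0 = excluded⇒decomposed , decomposed⇒excluded
  where
  open GreedyCorrespondence rankin order greedy

  Decomposed : Set
  Decomposed = ∃[ k ] ∃[ c ] ∃[ d ] (1 ≤ k × ¬ G k × gcd c d ≡ + 1 × z ≡ ((+ k * c) , (+ k * d)))

  excluded⇒decomposed : ¬ H z → Decomposed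
  excluded⇒decomposed z∉H with primitive-part z z≢0
  ... | c , d , prim , z≡ =
    content z , c , d , content-pos z≢0 ,
    (λ Gk → z∉H (Equivalence.from (correspondence z z≢0) Gk)) , prim , z≡

  decomposed⇒excluded : Decomposed → ¬ H z
  decomposed⇒excluded (k , c , d , _ , k∉G , prim , refl) Hz =
    k∉G (subst G (content-multiple k c d prim) (Equivalence.to (correspondence _ z≢0) Hz))
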